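{- For any formula $\alpha$ over a finite signature $\Sigma$, the set $[\![\alpha]\!]$ is total-closed, i.e. for every $v\in[\![\alpha]\!]$ also $v_t\in[\![\alpha]\!]$.
   Context: $\Sigma$ is a finite set of atoms. Formulas are given by $\alpha ::= \bot \mid p \mid \alpha_1\wedge\alpha_2 \mid \alpha_1\vee\alpha_2 \mid \alpha_1\rightarrow\alpha_2$ with $p\in\Sigma$. A partial interpretation is a map $v:\Sigma\to\{0,1,2\}$; $\mathcal I$ is the set of all of them and $\mathcal I_c$ the set of classical ones (no atom mapped to $1$). For $v\in\mathcal I$, $v_t\in\mathcal I_c$ is defined by $v_t(p)=2$ if $v(p)=1$ and $v_t(p)=v(p)$ otherwise. The order on $\mathcal I$: $u\le v$ iff for every atom $p$, $u(p)\le v(p)$ and ($u(p)=0$ implies $v(p)=0$). For $S\subseteq\mathcal I$: $\overline S=\mathcal I\setminus S$; $S_c=S\cap\mathcal I_c$; $S\downarrow=\{u\in\mathcal I:\exists v\in S,\ v\ge u\}$. The denotation: $[\![\bot]\!]=\emptyset$; $[\![p]\!]=\{v\in\mathcal I: v(p)=2\}$; $[\![\alpha\wedge\beta]\!]=[\![\alpha]\!]\cap[\![\beta]\!]$; $[\![\alpha\vee\beta]\!]=[\![\alpha]\!]\cup[\![\beta]\!]$; $[\![\alpha\to\beta]\!]=\big(\overline{[\![\alpha]\!]}\cup[\![\beta]\!]\big)\cap\big((\overline{[\![\alpha]\!]}\cup[\![\beta]\!])_c\big)\downarrow$. -}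

module Defs where

open import Data.Nat using (ℕ)
open import Data.Fin using (Fin)
open import Data.Product using (Σ; _×_; ∃-syntax)
open import Data.Sum using (_⊎_)
open import Data.Empty using (⊥)
open import Data.Unit using (⊤)
open import Relation.Nullary using (¬_)
open import Relation.Binary.PropositionalEquality using (_≡_)
open import Level using (0ℓ)
open import Relation.Unary using (Pred; _∩_; _∪_; ∁; ∅)

data V3 : Set where
  v0 v1 v2 : V3

-- The finite signature Σ is Fin n (n atoms).
data Formula (n : ℕ) : Set where
  ⊥f  : Formula n
  atom : Fin n → Formula n
  _∧f_ _∨f_ _⇒f_ : Formula n → Formula n → Formula n

Interp : ℕ → Set
Interp n = Fin n → V3

ISet : ℕ → Set₁
ISet n = Pred (Interp n) 0ℓ

Classical : ∀ {n} → Interp n → Set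
Classical v = ∀ p → ¬ (v p ≡ v1)

tot : V3 → V3
tot v0 = v0
tot v1 = v2
tot v2 = v2

_ₜ : ∀ {n} → Interp n → Interp n
(v ₜ) p = tot (v p)

_≤N_ : V3 → V3 → Set
v1 ≤N v0 = ⊥
v2 ≤N v0 = ⊥
v2 ≤N v1 = ⊥
_  ≤N _  = ⊤

_≤I_ : ∀ {n} → Interp n → Interp n → Set
u ≤I v = ∀ p → (u p ≤N v p) × (u p ≡ v0 → v p ≡ v0)

_c : ∀ {n} → ISet n → ISet n
(S c) v = S v × Classical v

_↓ : ∀ {n} → ISet n → ISet n
(S ↓) u = ∃[ v ] (S v × u ≤I v)

⟦_⟧ : ∀ {n} → Formula n → ISet n
⟦ ⊥f ⟧ = ∅
⟦ atom p ⟧ v = v p ≡ v2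
⟦ a ∧f b ⟧ = ⟦ a ⟧ ∩ ⟦ b ⟧
⟦ a ∨f b ⟧ = ⟦ a ⟧ ∪ ⟦ b ⟧
⟦ a ⇒f b ⟧ = (∁ ⟦ a ⟧ ∪ ⟦ b ⟧) ∩ (((∁ ⟦ a ⟧ ∪ ⟦ b ⟧) c) ↓)

TotalClosed : ∀ {n} → ISet n → Set
TotalClosed S = ∀ v → S v → S (v ₜ)

module Submission where

-- For an
-- implication the downward closure supplies a classical w ≥ v with w ∈ ∁⟦α⟧ ∪ ⟦β⟧;
-- but an interpretation below a classical one totalises to it, so v ₜ = w, and w
-- itself lies in ⟦α ⇒ β⟧ as it is classical and below itself.

open import Defs
open import Data.Nat using (ℕ)
open import Data.Product using (_,_)
open import Data.Sum using (inj₁; inj₂)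
open import Data.Empty using (⊥-elim)
open import Data.Unit using (tt)
open import Relation.Nullary using (¬_)
open import Relation.Unary using (∁; _∪_)
open import Relation.Binary.PropositionalEquality using (_≡_; _≗_; refl; sym; trans)

≤N-refl : ∀ x → x ≤N x
≤N-refl v0 = tt
≤N-refl v1 = tt
≤N-refl v2 = tt

≤I-refl : ∀ {n} (u : Interp n) → u ≤I u
≤I-refl u p = ≤N-refl (u p) , λ u≡0 → u≡0

≤I-respˡ-≗ : ∀ {n} {u v w : Interp n} → u ≗ v → u ≤I w → v ≤I w
≤I-respˡ-≗ u≗v u≤w p rewrite sym (u≗v p) = u≤w p

⟦⟧-resp-≗ : ∀ {n} (α : Formula n) {u v : Interp n} → u ≗ v → ⟦ α ⟧ u → ⟦ α ⟧ v
⟦⟧-resp-≗ ⊥f        u≗v ()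
⟦⟧-resp-≗ (atom p)  u≗v up≡2 = trans (sym (u≗v p)) up≡2
⟦⟧-resp-≗ (α ∧f β)  u≗v (uα , uβ) = ⟦⟧-resp-≗ α u≗v uα , ⟦⟧-resp-≗ β u≗v uβ
⟦⟧-resp-≗ (α ∨f β)  u≗v (inj₁ uα) = inj₁ (⟦⟧-resp-≗ α u≗v uα)
⟦⟧-resp-≗ (α ∨f β)  u≗v (inj₂ uβ) = inj₂ (⟦⟧-resp-≗ β u≗v uβ)
⟦⟧-resp-≗ (α ⇒f β) {u} {v} u≗v (u∈imp , w , w∈impc , u≤w) =
  ⟦⟧-resp-≗-imp u∈imp , w , w∈impc , ≤I-respˡ-≗ u≗v u≤w
  where
  ⟦⟧-resp-≗-imp : (∁ ⟦ α ⟧ ∪ ⟦ β ⟧) u → (∁ ⟦ α ⟧ ∪ ⟦ β ⟧) v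
  ⟦⟧-resp-≗-imp (inj₁ u∉α) = inj₁ λ vα → u∉α (⟦⟧-resp-≗ α (λ p → sym (u≗v p)) vα)
  ⟦⟧-resp-≗-imp (inj₂ uβ)  = inj₂ (⟦⟧-resp-≗ β u≗v uβ)

tot-below-classical : ∀ x y → x ≤N y → (x ≡ v0 → y ≡ v0) → ¬ (y ≡ v1) → tot x ≡ y
tot-below-classical v0 y  _  x≡0⇒y≡0 _ = sym (x≡0⇒y≡0 refl)
tot-below-classical v1 v1 _  _       y≢1 = ⊥-elim (y≢1 refl)
tot-below-classical v1 v2 _  _       _ = refl
tot-below-classical v2 v2 _  _       _ = refl

ₜ-below-classical : ∀ {n} {u w : Interp n} → u ≤I w → Classical w → u ₜ ≗ w
ₜ-below-classical {u = u} {w} u≤w w-classical p =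
  let (≤N-p , zero-p) = u≤w p in
  tot-below-classical (u p) (w p) ≤N-p zero-p (w-classical p)

⟦⇒f⟧-classical : ∀ {n} (α β : Formula n) {w : Interp n} →
                 ((∁ ⟦ α ⟧ ∪ ⟦ β ⟧) c) w → ⟦ α ⇒f β ⟧ w
⟦⇒f⟧-classical α β {w} w∈impc@(w∈imp , _) = w∈imp , w , w∈impc , ≤I-refl w

corollary2 : ∀ (n : ℕ) (α : Formula n) → TotalClosed ⟦ α ⟧
corollary2 n ⊥f       v ()
corollary2 n (atom p) v vp≡2 rewrite vp≡2 = refl
corollary2 n (α ∧f β) v (vα , vβ) = corollary2 n α v vα , corollary2 n β v vβ
corollary2 n (α ∨f β) v (inj₁ vα) = inj₁ (corollary2 n α v vα)
corollary2 n (α ∨f β) v (inj₂ vβ) = inj₂ (corollary2 n β v vβ)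
corollary2 n (α ⇒f β) v (_ , w , w∈impc@(_ , w-classical) , v≤w) =
  ⟦⟧-resp-≗ (α ⇒f β) (λ p → sym (ₜ-below-classical v≤w w-classical p))
            (⟦⇒f⟧-classical α β w∈impc)
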